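{- Let $d\geq 3$, let $W_d=\langle x_1,\ldots,x_d\mid x_1^2,\ldots,x_d^2\rangle$, let $y_i=x_ix_d$ for $i\in\{1,\ldots,d-1\}$, let $F_{d-1}=\langle y_1,\ldots,y_{d-1}\rangle$, and define $P_1=F_{d-1}$ and $P_i=[P_{i-1},F_{d-1}]P_{i-1}^2$ for $i\geq 2$. For integers $i\geq 1$ and $j\in\{0,\ldots,i\}$, let $M_{i,j}$ be the subgroup generated by $P_{i+1}$ together with all elements $[a_1,\ldots,a_{i-s}]^{2^s}$ with $a_1,\ldots,a_{i-s}\in\{y_1,\ldots,y_{d-1}\}$ and $j\leq s\leq i-1$ (so $M_{i,i}=P_{i+1}$). Let the symmetric group $\mathrm{Sym}(d)$ act on $W_d$ by automorphisms via $x_k^\sigma=x_{k^\sigma}$. Then for every $i\geq 2$ and every $j\in\{0,\ldots,i-2\}$, the subgroup $M_{i,j}$ is $\mathrm{Sym}(d)$-invariant, and $\mathrm{Sym}(d)$ acts faithfully on $M_{i,i-2}/M_{i,i}$.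
   Context: For a group $G$, $G^2=\langle g^2\mid g\in G\rangle$; $[h,k]=h^{ -1}k^{ -1}hk$, $[H,K]=\langle[h,k]\mid h\in H,k\in K\rangle$; commutators are left-normed: $[a_1]=a_1$ and $[a_1,\ldots,a_n]=[[a_1,\ldots,a_{n-1}],a_n]$. -}

module Defs where

open import Data.Nat using (ℕ; zero; suc; _≤_; _∸_; _+_)
open import Data.Fin using (Fin; inject₁; fromℕ)
open import Data.List using (List; []; _∷_; _++_; reverse; map; length; foldl)
open import Data.Product using (Σ; _×_; ∃)
open import Data.Sum using (_⊎_)
open import Relation.Binary.PropositionalEquality using (_≡_)
open import Data.Fin.Permutation using (Permutation′; _⟨$⟩ʳ_)

-- Throughout, d = suc m; letters x_1..x_d are the elements of Fin d,
-- x_d is the last letter  fromℕ m.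
-- Words in the letters represent elements of W_d.
Word : ℕ → Set
Word d = List (Fin d)

-- Equality in W_d = <x_1..x_d | x_k^2>: the congruence on words generated
-- by the relations x_k x_k = 1 (since x_k^{-1} = x_k, the monoid
-- presentation gives exactly the group W_d).
data _≈_ {d : ℕ} : Word d → Word d → Set where
  ≈-refl  : ∀ {u} → u ≈ u
  ≈-sym   : ∀ {u v} → u ≈ v → v ≈ u
  ≈-trans : ∀ {u v w} → u ≈ v → v ≈ w → u ≈ w
  ≈-cancel : ∀ u k v → (u ++ k ∷ k ∷ v) ≈ (u ++ v)

-- group operations on words: product = concatenation, inverse = reversal
inv : ∀ {d} → Word d → Word d
inv = reverse

comm : ∀ {d} → Word d → Word d → Word d
comm h k = inv h ++ inv k ++ h ++ k

pow2 : ∀ {d} → ℕ → Word d → Word d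
pow2 zero    g = g
pow2 (suc s) g = pow2 s (g ++ g)

data Gen {d : ℕ} (S : Word d → Set) : Word d → Set where
  base : ∀ {w} → S w → Gen S w
  one  : Gen S []
  mul  : ∀ {u v} → Gen S u → Gen S v → Gen S (u ++ v)
  ginv : ∀ {u} → Gen S u → Gen S (inv u)
  resp : ∀ {u v} → u ≈ v → Gen S u → Gen S v

module _ (m : ℕ) where
  -- y_i = x_i x_d, i ∈ {1..d-1} indexed by Fin m
  y : Fin m → Word (suc m)
  y i = inject₁ i ∷ fromℕ m ∷ []

  F : Word (suc m) → Set
  F = Gen (λ w → ∃ λ i → w ≡ y i)

  P : ℕ → Word (suc m) → Set
  P zero = F            -- junk value, P is used only for indices ≥ 1
  P (suc zero) = F
  P (suc (suc i)) = Gen (λ w →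
      (Σ (Word (suc m)) λ a → Σ (Word (suc m)) λ b →
          P (suc i) a × F b × w ≡ comm a b)
    ⊎ (Σ (Word (suc m)) λ a → P (suc i) a × w ≡ a ++ a))

  leftComm : List (Fin m) → Word (suc m)
  leftComm [] = []
  leftComm (a ∷ as) = foldl (λ c b → comm c (y b)) (y a) as

  M : ℕ → ℕ → Word (suc m) → Set
  M i j = Gen (λ w → P (suc i) w
    ⊎ (Σ ℕ λ s → j ≤ s × suc s ≤ i ×
        Σ (List (Fin m)) λ as → length as ≡ i ∸ s × w ≡ pow2 s (leftComm as)))

  act : Permutation′ (suc m) → Word (suc m) → Word (suc m)
  act σ w = map (σ ⟨$⟩ʳ_) w

module Submission where

-- Sym(d) acts on W_d by endomorphisms preserving F, hence every
-- P_k.  It sends a power generator [y_{a₁},…,y_{aₙ}]^(2^s) of M_{i,j}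
-- (s + n = i) to [f₁,…,fₙ]^(2^s) with all fₖ ∈ F.  Such a commutator lies in
-- the layer ⟨basic commutators of weight n, P_{n+1}⟩, and a Hall–Petresco type
-- computation shows that x ↦ x^(2^s) maps this layer into M_{i,j}: for n ≥ 2
-- it is multiplicative modulo P_{i+1}; for n = 1 it produces the correction
-- [b,a]^(2^(s-1)), which lies in M_{i,j} exactly because j ≤ i-2.
--
-- Let x_k act on ℤ by the reflection x ↦ t_k − x.  Elements of
-- P_{k+1} then translate by multiples of 2^k, so M_{i,i} = P_{i+1} by multiples
-- of 2^i.  For σ ≠ 1 an indicator function t makes w⁻¹σ(w) translate by
-- −2^(i-1), where w = y_a^(2^(i-1)) ∈ M_{i,i-2}; so σ moves the coset of w.

open import Defs
open import Data.Nat using (ℕ; zero; suc; _≤_; _∸_; s≤s; z≤n)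
open import Data.Fin using (Fin; zero; suc; fromℕ; inject₁)
open import Data.Bool using (Bool; true; false; not)
open import Data.Vec using (Vec; _∷_; []; lookup)
open import Data.List using (List; []; _∷_; _++_; _∷ʳ_; reverse; map; [_]; foldl; length)
open import Data.List.Properties
  using (++-assoc; ++-identityʳ; reverse-++; reverse-involutive; unfold-reverse; length-++; foldl-∷ʳ; map-++; reverse-map)
open import Data.Product using (Σ; _×_; _,_)
open import Data.Sum using (_⊎_; inj₁; inj₂)
open import Data.Empty using (⊥; ⊥-elim)
open import Relation.Nullary using (yes; no; ¬_)
open import Relation.Binary.PropositionalEquality
  using (_≡_; refl; sym; trans; cong; cong₂; subst)
open import Data.Fin.Permutation using (Permutation′; _⟨$⟩ʳ_; _⟨$⟩ˡ_; inverseˡ)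
open import Function using (_∘_)
import Data.Fin.Properties as Fin
import Data.Integer
open import Data.Nat.Properties using (+-suc; +-comm; +-identityʳ; ≤-refl; ≤-trans; n≤1+n; 1+n≰n; m≤m+n; m+n∸m≡n; m+n∸n≡m; m+[n∸m]≡n; suc-injective; <⇒≤)
open import Level using (0ℓ)
open import Relation.Binary.Bundles using (Setoid)
import Relation.Binary.Reasoning.Setoid
import Data.Bool.Properties as Bool

module _ {d : ℕ} where

  ≈-setoid : Setoid 0ℓ 0ℓ
  ≈-setoid = record
    { Carrier = Word d ; _≈_ = _≈_
    ; isEquivalence = record { refl = ≈-refl ; sym = ≈-sym ; trans = ≈-trans } }

  ≡⇒≈ : {u v : Word d} → u ≡ v → u ≈ v
  ≡⇒≈ refl = ≈-refl

  infixr 4 _⟫_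
  _⟫_ : {u v w : Word d} → u ≈ v → v ≈ w → u ≈ w
  _⟫_ = ≈-trans

  ++-congˡ : (a : Word d) {u v : Word d} → u ≈ v → (a ++ u) ≈ (a ++ v)
  ++-congˡ a ≈-refl = ≈-refl
  ++-congˡ a (≈-sym p) = ≈-sym (++-congˡ a p)
  ++-congˡ a (≈-trans p q) = ++-congˡ a p ⟫ ++-congˡ a q
  ++-congˡ a (≈-cancel u k v) =
    ≡⇒≈ (sym (++-assoc a u (k ∷ k ∷ v))) ⟫ ≈-cancel (a ++ u) k v ⟫ ≡⇒≈ (++-assoc a u v)

  ++-congʳ : (b : Word d) {u v : Word d} → u ≈ v → (u ++ b) ≈ (v ++ b)
  ++-congʳ b ≈-refl = ≈-refl
  ++-congʳ b (≈-sym p) = ≈-sym (++-congʳ b p)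
  ++-congʳ b (≈-trans p q) = ++-congʳ b p ⟫ ++-congʳ b q
  ++-congʳ b (≈-cancel u k v) =
    ≡⇒≈ (++-assoc u (k ∷ k ∷ v) b) ⟫ ≈-cancel u k (v ++ b) ⟫ ≡⇒≈ (sym (++-assoc u v b))

  ++-cong : {u u′ v v′ : Word d} → u ≈ u′ → v ≈ v′ → (u ++ v) ≈ (u′ ++ v′)
  ++-cong {u′ = u′} {v = v} p q = ++-congʳ v p ⟫ ++-congˡ u′ q

  -- reversal maps each relator x_k x_k to itself
  inv-cong : {u v : Word d} → u ≈ v → inv u ≈ inv v
  inv-cong ≈-refl = ≈-refl
  inv-cong (≈-sym p) = ≈-sym (inv-cong p)
  inv-cong (≈-trans p q) = inv-cong p ⟫ inv-cong q
  inv-cong (≈-cancel u k v) =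
    ≡⇒≈ reversed ⟫ ≈-cancel (reverse v) k (reverse u) ⟫ ≡⇒≈ (sym (reverse-++ u v))
    where
    reversed : reverse (u ++ k ∷ k ∷ v) ≡ reverse v ++ k ∷ k ∷ reverse u
    reversed = trans (reverse-++ u (k ∷ k ∷ v))
      (trans (cong (_++ reverse u) (trans (unfold-reverse k (k ∷ v))
        (trans (cong (_++ [ k ]) (unfold-reverse k v)) (++-assoc (reverse v) [ k ] [ k ]))))
      (++-assoc (reverse v) (k ∷ k ∷ []) (reverse u)))

  inv-cancelˡ : (u : Word d) → (inv u ++ u) ≈ []
  inv-cancelˡ [] = ≈-refl
  inv-cancelˡ (k ∷ u) =
    ≡⇒≈ (trans (cong (_++ k ∷ u) (unfold-reverse k u)) (++-assoc (reverse u) [ k ] (k ∷ u)))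
    ⟫ ≈-cancel (reverse u) k u ⟫ inv-cancelˡ u

  inv-cancelʳ : (u : Word d) → (u ++ inv u) ≈ []
  inv-cancelʳ u =
    ≡⇒≈ (cong (_++ reverse u) (sym (reverse-involutive u))) ⟫ inv-cancelˡ (reverse u)

-- A decision procedure for identities in free groups, valid in W_d for words
-- substituted for the variables: flatten an expression to a list of signed
-- variables and cancel adjacent inverse pairs.
module FreeGroupSolver {d : ℕ} where
  open import Data.Nat using (_+_)

  infixr 5 _⊕_
  data Expr (n : ℕ) : Set where
    var : Fin n → Expr n
    _⊕_ : Expr n → Expr n → Expr n
    ι   : Expr n → Expr n
    ε   : Expr n

  ⟦_⟧ : {n : ℕ} → Expr n → Vec (Word d) n → Word d
  ⟦ var i ⟧ ρ = lookup ρ i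
  ⟦ e ⊕ f ⟧ ρ = ⟦ e ⟧ ρ ++ ⟦ f ⟧ ρ
  ⟦ ι e ⟧ ρ = inv (⟦ e ⟧ ρ)
  ⟦ ε ⟧ ρ = []

  Literal : ℕ → Set
  Literal n = Fin n × Bool

  ⟦_⟧ₗ : {n : ℕ} → Literal n → Vec (Word d) n → Word d
  ⟦ i , false ⟧ₗ ρ = lookup ρ i
  ⟦ i , true ⟧ₗ ρ = inv (lookup ρ i)

  ⟦_⟧* : {n : ℕ} → List (Literal n) → Vec (Word d) n → Word d
  ⟦ [] ⟧* ρ = []
  ⟦ a ∷ l ⟧* ρ = ⟦ a ⟧ₗ ρ ++ ⟦ l ⟧* ρ

  invertₗ : {n : ℕ} → Literal n → Literal n
  invertₗ (i , b) = i , not b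

  flatten : {n : ℕ} → Expr n → List (Literal n)
  flatten (var i) = (i , false) ∷ []
  flatten (e ⊕ f) = flatten e ++ flatten f
  flatten (ι e) = reverse (map invertₗ (flatten e))
  flatten ε = []

  ⟦++⟧ : ∀ {n : ℕ} (l l′ : List (Literal n)) ρ → ⟦ l ++ l′ ⟧* ρ ≡ ⟦ l ⟧* ρ ++ ⟦ l′ ⟧* ρ
  ⟦++⟧ [] l′ ρ = refl
  ⟦++⟧ (a ∷ l) l′ ρ = trans (cong (⟦ a ⟧ₗ ρ ++_) (⟦++⟧ l l′ ρ)) (sym (++-assoc (⟦ a ⟧ₗ ρ) _ _))

  ⟦invertₗ⟧ : ∀ {n : ℕ} (a : Literal n) ρ → ⟦ invertₗ a ⟧ₗ ρ ≡ inv (⟦ a ⟧ₗ ρ)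
  ⟦invertₗ⟧ (i , false) ρ = refl
  ⟦invertₗ⟧ (i , true) ρ = sym (reverse-involutive _)

  ⟦invert⟧ : ∀ {n : ℕ} (l : List (Literal n)) ρ → ⟦ reverse (map invertₗ l) ⟧* ρ ≡ inv (⟦ l ⟧* ρ)
  ⟦invert⟧ [] ρ = refl
  ⟦invert⟧ (a ∷ l) ρ =
    trans (cong (λ z → ⟦ z ⟧* ρ) (unfold-reverse (invertₗ a) (map invertₗ l)))
    (trans (⟦++⟧ (reverse (map invertₗ l)) [ invertₗ a ] ρ)
    (trans (cong₂ _++_ (⟦invert⟧ l ρ) (trans (++-identityʳ _) (⟦invertₗ⟧ a ρ)))
      (sym (reverse-++ (⟦ a ⟧ₗ ρ) (⟦ l ⟧* ρ)))))

  flatten-sound : ∀ {n : ℕ} (e : Expr n) ρ → ⟦ e ⟧ ρ ≡ ⟦ flatten e ⟧* ρ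
  flatten-sound (var i) ρ = sym (++-identityʳ _)
  flatten-sound (e ⊕ f) ρ =
    trans (cong₂ _++_ (flatten-sound e ρ) (flatten-sound f ρ)) (sym (⟦++⟧ (flatten e) (flatten f) ρ))
  flatten-sound (ι e) ρ = trans (cong inv (flatten-sound e ρ)) (sym (⟦invert⟧ (flatten e) ρ))
  flatten-sound ε ρ = refl

  push : {n : ℕ} → Literal n → List (Literal n) → List (Literal n)
  push a [] = a ∷ []
  push (i , b) ((j , c) ∷ l) with i Fin.≟ j | b Bool.≟ not c
  ... | yes _ | yes _ = l
  ... | _     | _     = (i , b) ∷ (j , c) ∷ l

  reduce : {n : ℕ} → List (Literal n) → List (Literal n)
  reduce [] = []
  reduce (a ∷ l) = push a (reduce l)

  push-sound : ∀ {n : ℕ} (a : Literal n) l ρ → ⟦ push a l ⟧* ρ ≈ (⟦ a ⟧ₗ ρ ++ ⟦ l ⟧* ρ)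
  push-sound a [] ρ = ≈-refl
  push-sound (i , b) ((j , c) ∷ l) ρ with i Fin.≟ j | b Bool.≟ not c
  ... | yes refl | yes refl = ≈-sym (cancel c)
    where
    rest : Word d
    rest = ⟦ l ⟧* ρ
    cancel : ∀ c → (⟦ i , not c ⟧ₗ ρ ++ ⟦ i , c ⟧ₗ ρ ++ rest) ≈ rest
    cancel false = ≡⇒≈ (sym (++-assoc (inv (lookup ρ i)) _ rest))
      ⟫ ++-congʳ rest (inv-cancelˡ (lookup ρ i))
    cancel true = ≡⇒≈ (sym (++-assoc (lookup ρ i) _ rest))
      ⟫ ++-congʳ rest (inv-cancelʳ (lookup ρ i))
  ... | yes _ | no _ = ≈-refl
  ... | no _  | _    = ≈-refl

  reduce-sound : ∀ {n : ℕ} (l : List (Literal n)) ρ → ⟦ reduce l ⟧* ρ ≈ ⟦ l ⟧* ρ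
  reduce-sound [] ρ = ≈-refl
  reduce-sound (a ∷ l) ρ = push-sound a (reduce l) ρ ⟫ ++-congˡ (⟦ a ⟧ₗ ρ) (reduce-sound l ρ)

  solve : {n : ℕ} (e f : Expr n) → reduce (flatten e) ≡ reduce (flatten f) →
          (ρ : Vec (Word d) n) → ⟦ e ⟧ ρ ≈ ⟦ f ⟧ ρ
  solve e f same ρ =
    ≡⇒≈ (flatten-sound e ρ) ⟫ ≈-sym (reduce-sound (flatten e) ρ)
    ⟫ ≡⇒≈ (cong (λ l → ⟦ l ⟧* ρ) same)
    ⟫ reduce-sound (flatten f) ρ ⟫ ≡⇒≈ (sym (flatten-sound f ρ))

  x₀ : {n : ℕ} → Expr (1 + n)
  x₀ = var zero
  x₁ : {n : ℕ} → Expr (2 + n)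
  x₁ = var (suc zero)
  x₂ : {n : ℕ} → Expr (3 + n)
  x₂ = var (suc (suc zero))
  x₃ : {n : ℕ} → Expr (4 + n)
  x₃ = var (suc (suc (suc zero)))
  x₄ : {n : ℕ} → Expr (5 + n)
  x₄ = var (suc (suc (suc (suc zero))))
  x₅ : {n : ℕ} → Expr (6 + n)
  x₅ = var (suc (suc (suc (suc (suc zero)))))
  x₆ : {n : ℕ} → Expr (7 + n)
  x₆ = var (suc (suc (suc (suc (suc (suc zero))))))

  [_,_]ₑ : {n : ℕ} → Expr n → Expr n → Expr n
  [ e , f ]ₑ = ι e ⊕ ι f ⊕ e ⊕ f

open FreeGroupSolver

module _ {d : ℕ} where

  record IsSubgroup (H : Word d → Set) : Set where
    field
      ∈-one  : H []
      ∈-mul  : {u v : Word d} → H u → H v → H (u ++ v)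
      ∈-inv  : {u : Word d} → H u → H (inv u)
      ∈-resp : {u v : Word d} → u ≈ v → H u → H v

  Gen-isSubgroup : (S : Word d → Set) → IsSubgroup (Gen S)
  Gen-isSubgroup S = record { ∈-one = one ; ∈-mul = mul ; ∈-inv = ginv ; ∈-resp = resp }

  Gen-least : {S H : Word d → Set} → IsSubgroup H → (∀ {w} → S w → H w) →
              ∀ {w} → Gen S w → H w
  Gen-least H-sub S⊆H (base s) = S⊆H s
  Gen-least H-sub S⊆H one = IsSubgroup.∈-one H-sub
  Gen-least H-sub S⊆H (mul p q) = IsSubgroup.∈-mul H-sub (Gen-least H-sub S⊆H p) (Gen-least H-sub S⊆H q)
  Gen-least H-sub S⊆H (ginv p) = IsSubgroup.∈-inv H-sub (Gen-least H-sub S⊆H p)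
  Gen-least H-sub S⊆H (resp e p) = IsSubgroup.∈-resp H-sub e (Gen-least H-sub S⊆H p)

  record IsEndo (f : Word d → Word d) : Set where
    field
      f-cong : {u v : Word d} → u ≈ v → f u ≈ f v
      f-++   : (u v : Word d) → f (u ++ v) ≈ (f u ++ f v)
      f-inv  : (u : Word d) → f (inv u) ≈ inv (f u)
      f-[]   : f [] ≈ []

    f-comm : (a b : Word d) → f (comm a b) ≈ comm (f a) (f b)
    f-comm a b =
      f-++ (inv a) _ ⟫ ++-congˡ (f (inv a)) (f-++ (inv b) _ ⟫ ++-congˡ (f (inv b)) (f-++ a b))
      ⟫ ++-cong (f-inv a) (++-cong (f-inv b) ≈-refl)

  preimage-isSubgroup : {f : Word d → Word d} {H : Word d → Set} →
    IsEndo f → IsSubgroup H → IsSubgroup (λ w → H (f w))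
  preimage-isSubgroup {f} endo H-sub = record
    { ∈-one  = ∈-resp (≈-sym f-[]) ∈-one
    ; ∈-mul  = λ {u} {v} p q → ∈-resp (≈-sym (f-++ u v)) (∈-mul p q)
    ; ∈-inv  = λ {u} p → ∈-resp (≈-sym (f-inv u)) (∈-inv p)
    ; ∈-resp = λ e → ∈-resp (f-cong e) }
    where open IsEndo endo
          open IsSubgroup H-sub

  Gen-image : {S T : Word d → Set} {f : Word d → Word d} → IsEndo f →
    (∀ {w} → S w → Gen T (f w)) → ∀ {w} → Gen S w → Gen T (f w)
  Gen-image endo = Gen-least (preimage-isSubgroup endo (Gen-isSubgroup _))

  conj : Word d → Word d → Word d
  conj w u = inv w ++ u ++ w

  conj-isEndo : (w : Word d) → IsEndo (conj w)
  conj-isEndo w = record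
    { f-cong = λ e → ++-congˡ (inv w) (++-congʳ w e)
    ; f-++ = λ u v → solve (ι x₀ ⊕ (x₁ ⊕ x₂) ⊕ x₀) ((ι x₀ ⊕ x₁ ⊕ x₀) ⊕ (ι x₀ ⊕ x₂ ⊕ x₀)) refl (w ∷ u ∷ v ∷ [])
    ; f-inv = λ u → solve (ι x₀ ⊕ ι x₁ ⊕ x₀) (ι (ι x₀ ⊕ x₁ ⊕ x₀)) refl (w ∷ u ∷ [])
    ; f-[] = solve (ι x₀ ⊕ ε ⊕ x₀) ε refl (w ∷ []) }

  IsNormal : (Word d → Set) → Set
  IsNormal H = (w : Word d) {u : Word d} → H u → H (conj w u)

  comm-cong : {a a′ b b′ : Word d} → a ≈ a′ → b ≈ b′ → comm a b ≈ comm a′ b′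
  comm-cong e f = ++-cong (inv-cong e) (++-cong (inv-cong f) (++-cong e f))

  comm-[]ʳ : (x : Word d) → comm x [] ≈ []
  comm-[]ʳ x = solve [ x₀ , ε ]ₑ ε refl (x ∷ [])

  comm-[]ˡ : (x : Word d) → comm [] x ≈ []
  comm-[]ˡ x = solve [ ε , x₀ ]ₑ ε refl (x ∷ [])

  comm-++ʳ : (b u v : Word d) → comm b (u ++ v) ≈ (comm b v ++ comm b u ++ comm (comm b u) v)
  comm-++ʳ b u v = solve [ x₀ , x₁ ⊕ x₂ ]ₑ ([ x₀ , x₂ ]ₑ ⊕ [ x₀ , x₁ ]ₑ ⊕ [ [ x₀ , x₁ ]ₑ , x₂ ]ₑ) refl (b ∷ u ∷ v ∷ [])

  comm-invʳ : (b u : Word d) → comm b (inv u) ≈ (inv (comm b u) ++ comm (inv (comm b u)) (inv u))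
  comm-invʳ b u = solve [ x₀ , ι x₁ ]ₑ (ι [ x₀ , x₁ ]ₑ ⊕ [ ι [ x₀ , x₁ ]ₑ , ι x₁ ]ₑ) refl (b ∷ u ∷ [])

  comm-++ˡ : (a b u : Word d) → comm (a ++ b) u ≈ (comm a u ++ comm (comm a u) b ++ comm b u)
  comm-++ˡ a b u = solve [ x₀ ⊕ x₁ , x₂ ]ₑ ([ x₀ , x₂ ]ₑ ⊕ [ [ x₀ , x₂ ]ₑ , x₁ ]ₑ ⊕ [ x₁ , x₂ ]ₑ) refl (a ∷ b ∷ u ∷ [])

  comm-invˡ : (a u : Word d) → comm (inv a) u ≈ (inv (comm a u) ++ comm (inv (comm a u)) (inv a))
  comm-invˡ a u = solve [ ι x₀ , x₁ ]ₑ (ι [ x₀ , x₁ ]ₑ ⊕ [ ι [ x₀ , x₁ ]ₑ , ι x₀ ]ₑ) refl (a ∷ u ∷ [])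

module Modulo {d : ℕ} {H : Word d → Set} (H-sub : IsSubgroup H) (H-normal : IsNormal H) where
  open IsSubgroup H-sub

  infix 4 _∼_
  record _∼_ (u v : Word d) : Set where
    constructor ⟨_⟩
    field difference : H (inv u ++ v)

  ≈⇒∼ : {u v : Word d} → u ≈ v → u ∼ v
  ≈⇒∼ {u} e = ⟨ ∈-resp (≈-sym (++-congˡ (inv u) (≈-sym e) ⟫ inv-cancelˡ u)) ∈-one ⟩

  ∼-sym : {u v : Word d} → u ∼ v → v ∼ u
  ∼-sym {u} {v} ⟨ p ⟩ = ⟨ ∈-resp (solve (ι (ι x₀ ⊕ x₁)) (ι x₁ ⊕ x₀) refl (u ∷ v ∷ [])) (∈-inv p) ⟩

  ∼-trans : {u v w : Word d} → u ∼ v → v ∼ w → u ∼ w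
  ∼-trans {u} {v} {w} ⟨ p ⟩ ⟨ q ⟩ =
    ⟨ ∈-resp (solve ((ι x₀ ⊕ x₁) ⊕ (ι x₁ ⊕ x₂)) (ι x₀ ⊕ x₂) refl (u ∷ v ∷ w ∷ [])) (∈-mul p q) ⟩

  -- normality makes ∼ a congruence for multiplication
  ∼-cong : {u u′ v v′ : Word d} → u ∼ u′ → v ∼ v′ → (u ++ v) ∼ (u′ ++ v′)
  ∼-cong {u} {u′} {v} {v′} ⟨ p ⟩ ⟨ q ⟩ =
    ⟨ ∈-resp (solve ((ι x₂ ⊕ (ι x₀ ⊕ x₁) ⊕ x₂) ⊕ (ι x₂ ⊕ x₃)) (ι (x₀ ⊕ x₂) ⊕ x₁ ⊕ x₃) refl (u ∷ u′ ∷ v ∷ v′ ∷ []))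
        (∈-mul (H-normal v p) q) ⟩

  ∼-drop : {u r : Word d} → H r → (u ++ r) ∼ u
  ∼-drop {u} {r} p = ⟨ ∈-resp (solve (ι x₁) (ι (x₀ ⊕ x₁) ⊕ x₀) refl (u ∷ r ∷ [])) (∈-inv p) ⟩

  ∼-∈ : {u v : Word d} → u ∼ v → H u → H v
  ∼-∈ {u} {v} ⟨ p ⟩ q = ∈-resp (solve (x₀ ⊕ ι x₀ ⊕ x₁) x₁ refl (u ∷ v ∷ [])) (∈-mul q p)

module ≈-Reasoning {d : ℕ} = Relation.Binary.Reasoning.Setoid (≈-setoid {d})

module _ {d : ℕ} where

  pow2-cong : (s : ℕ) {u v : Word d} → u ≈ v → pow2 s u ≈ pow2 s v
  pow2-cong zero e = e
  pow2-cong (suc s) e = pow2-cong s (++-cong e e)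

  pow2-inv : (s : ℕ) (u : Word d) → pow2 s (inv u) ≡ inv (pow2 s u)
  pow2-inv zero u = refl
  pow2-inv (suc s) u = trans (cong (pow2 s) (sym (reverse-++ u u))) (pow2-inv s (u ++ u))

  pow2-[] : (s : ℕ) → pow2 {d} s [] ≡ []
  pow2-[] zero = refl
  pow2-[] (suc s) = pow2-[] s

  Factor : (Word d → Set) → Word d → Word d → Set
  Factor H u v = Σ (Word d) λ r → H r × (u ≈ (v ++ r))

  square-of-product : (a b : Word d) →
    ((a ++ b) ++ (a ++ b)) ≈ ((a ++ a) ++ ((b ++ b) ++ conj b (comm b a)))
  square-of-product a b =
    solve ((x₀ ⊕ x₁) ⊕ (x₀ ⊕ x₁)) ((x₀ ⊕ x₀) ⊕ ((x₁ ⊕ x₁) ⊕ (ι x₁ ⊕ [ x₁ , x₀ ]ₑ ⊕ x₁))) refl (a ∷ b ∷ [])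

last-or-inject : {n : ℕ} (p : Fin (suc n)) → (p ≡ fromℕ n) ⊎ (Σ (Fin n) λ q → p ≡ inject₁ q)
last-or-inject {zero} zero = inj₁ refl
last-or-inject {suc n} zero = inj₂ (zero , refl)
last-or-inject {suc n} (suc p) with last-or-inject p
... | inj₁ e = inj₁ (cong suc e)
... | inj₂ (q , e) = inj₂ (suc q , cong suc e)

-- The lower exponent-2 series of F = F_{d-1} inside W_d, d = suc m.
-- 𝒫 k denotes P_{k+1}, so that 𝒫 0 = F and 𝒫 (suc k) = [𝒫 k, F] (𝒫 k)².
module Series (m : ℕ) where
  open import Data.Nat using (_+_)

  𝒫 : ℕ → Word (suc m) → Set
  𝒫 k = P m (suc k)

  𝒫-generator : ℕ → Word (suc m) → Set
  𝒫-generator k w = (Σ (Word (suc m)) λ a → Σ (Word (suc m)) λ b → 𝒫 k a × F m b × w ≡ comm a b)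
                  ⊎ (Σ (Word (suc m)) λ a → 𝒫 k a × w ≡ a ++ a)

  𝒫-comm : (k : ℕ) {a b : Word (suc m)} → 𝒫 k a → F m b → 𝒫 (suc k) (comm a b)
  𝒫-comm k pa fb = base (inj₁ (_ , _ , pa , fb , refl))

  𝒫-square : (k : ℕ) {a : Word (suc m)} → 𝒫 k a → 𝒫 (suc k) (a ++ a)
  𝒫-square k pa = base (inj₂ (_ , pa , refl))

  𝒫-isSubgroup : (k : ℕ) → IsSubgroup (𝒫 k)
  𝒫-isSubgroup zero = Gen-isSubgroup _
  𝒫-isSubgroup (suc k) = Gen-isSubgroup _

  module _ (k : ℕ) where
    open IsSubgroup (𝒫-isSubgroup k) public
      renaming (∈-one to 𝒫-one; ∈-mul to 𝒫-mul; ∈-inv to 𝒫-inv; ∈-resp to 𝒫-resp)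

  𝒫-cast : {k l : ℕ} {w : Word (suc m)} → k ≡ l → 𝒫 k w → 𝒫 l w
  𝒫-cast refl p = p

  -- F contains every product x_p x_q of two letters (it is the even-length subgroup)
  pair∈F : (p q : Fin (suc m)) → F m (p ∷ q ∷ [])
  pair∈F p q with last-or-inject p | last-or-inject q
  ... | inj₁ refl | inj₁ refl = resp (≈-sym (≈-cancel [] (fromℕ m) [])) one
  ... | inj₁ refl | inj₂ (q′ , refl) = ginv (base (q′ , refl))
  ... | inj₂ (p′ , refl) | inj₁ refl = base (p′ , refl)
  ... | inj₂ (p′ , refl) | inj₂ (q′ , refl) =
    resp (≈-cancel [ inject₁ p′ ] (fromℕ m) [ inject₁ q′ ]) (mul (base (p′ , refl)) (ginv (base (q′ , refl))))

  𝒫-preserved : {f : Word (suc m) → Word (suc m)} → IsEndo f →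
    (∀ {w} → F m w → F m (f w)) → ∀ k {w} → 𝒫 k w → 𝒫 k (f w)
  𝒫-preserved endo f-F zero = f-F
  𝒫-preserved {f} endo f-F (suc k) = Gen-image endo on-generators
    where
    open IsEndo endo
    on-generators : ∀ {w} → 𝒫-generator k w → 𝒫 (suc k) (f w)
    on-generators (inj₁ (a , b , pa , fb , refl)) =
      resp (≈-sym (f-comm a b)) (𝒫-comm k (𝒫-preserved endo f-F k pa) (f-F fb))
    on-generators (inj₂ (a , pa , refl)) = resp (≈-sym (f-++ a a)) (𝒫-square k (𝒫-preserved endo f-F k pa))

  -- F is normal in W_d: conjugating y_a by a letter x gives (x x_a)(x_d x)
  F-normal : IsNormal (F m)
  F-normal [] {u} p = resp (solve x₀ (ι ε ⊕ x₀ ⊕ ε) refl (u ∷ [])) p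
  F-normal (x ∷ w) {u} p =
    resp (solve (ι x₁ ⊕ (ι x₀ ⊕ x₂ ⊕ x₀) ⊕ x₁) (ι (x₀ ⊕ x₁) ⊕ x₂ ⊕ x₀ ⊕ x₁) refl ([ x ] ∷ w ∷ u ∷ []))
      (F-normal w (Gen-image (conj-isEndo [ x ])
        (λ { (a , refl) → mul (pair∈F x (inject₁ a)) (pair∈F (fromℕ m) x) }) p))

  𝒫-normal : (k : ℕ) → IsNormal (𝒫 k)
  𝒫-normal k w = 𝒫-preserved (conj-isEndo w) (F-normal w) k

  𝒫-step : (k : ℕ) {w : Word (suc m)} → 𝒫 (suc k) w → 𝒫 k w
  𝒫-step k = Gen-least (𝒫-isSubgroup k) λ
    { (inj₁ (a , b , pa , fb , refl)) → 𝒫-mul k (𝒫-inv k pa) (𝒫-normal k b pa)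
    ; (inj₂ (a , pa , refl)) → 𝒫-mul k pa pa }

  𝒫⊆F : (k : ℕ) {w : Word (suc m)} → 𝒫 k w → F m w
  𝒫⊆F zero p = p
  𝒫⊆F (suc k) p = 𝒫⊆F k (𝒫-step k p)

  𝒫⊆𝒫₁ : (k : ℕ) {w : Word (suc m)} → 𝒫 (suc k) w → 𝒫 1 w
  𝒫⊆𝒫₁ zero p = p
  𝒫⊆𝒫₁ (suc k) p = 𝒫⊆𝒫₁ k (𝒫-step (suc k) p)

  module Mod𝒫 (k : ℕ) = Modulo (𝒫-isSubgroup k) (𝒫-normal k)

  𝒫-central : (k : ℕ) {t f : Word (suc m)} → 𝒫 k t → F m f → Mod𝒫._∼_ (suc k) (t ++ f) (f ++ t)
  𝒫-central k {t} {f} pt ff =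
    record { difference = 𝒫-resp (suc k) (solve (ι [ x₀ , x₁ ]ₑ) (ι (x₀ ⊕ x₁) ⊕ x₁ ⊕ x₀) refl (t ∷ f ∷ []))
      (𝒫-inv (suc k) (𝒫-comm k pt ff)) }

  -- For x ∈ 𝒫 k the map φ = [x, _] sends F into
  -- 𝒫 (k+1) and is a homomorphism modulo 𝒫 (k+2), because 𝒫 (k+1) is central
  -- modulo 𝒫 (k+2); hence it kills commutators and squares modulo 𝒫 (k+2).
  module CommutatorWith𝒫₁ (k : ℕ) {x : Word (suc m)} (px : 𝒫 k x) where
    K : ℕ
    K = suc (suc k)

    open Mod𝒫 K

    φ : Word (suc m) → Word (suc m)
    φ u = comm x u

    φ∈𝒫 : {u : Word (suc m)} → F m u → 𝒫 (suc k) (φ u)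
    φ∈𝒫 fu = 𝒫-comm k px fu

    φ-++ : {u v : Word (suc m)} → F m u → F m v → φ (u ++ v) ∼ (φ u ++ φ v)
    φ-++ {u} {v} fu fv =
      ∼-trans (≈⇒∼ (comm-++ʳ x u v ⟫ ≡⇒≈ (sym (++-assoc (φ v) (φ u) _))))
        (∼-trans (∼-drop (𝒫-comm (suc k) (φ∈𝒫 fu) fv)) (𝒫-central (suc k) (φ∈𝒫 fv) (𝒫⊆F (suc k) (φ∈𝒫 fu))))

    φ-inv : {u : Word (suc m)} → F m u → φ (inv u) ∼ inv (φ u)
    φ-inv {u} fu = ∼-trans (≈⇒∼ (comm-invʳ x u)) (∼-drop (𝒫-comm (suc k) (𝒫-inv (suc k) (φ∈𝒫 fu)) (ginv fu)))

    φ-comm : {a b : Word (suc m)} → F m a → F m b → 𝒫 K (φ (comm a b))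
    φ-comm {a} {b} fa fb =
      ∼-∈ (∼-sym expand) (𝒫-comm (suc k) (φ∈𝒫 fa) (𝒫⊆F (suc k) (φ∈𝒫 fb)))
      where
      expand : φ (comm a b) ∼ comm (φ a) (φ b)
      expand = ∼-trans (φ-++ (ginv fa) (mul (ginv fb) (mul fa fb)))
        (∼-cong (φ-inv fa) (∼-trans (φ-++ (ginv fb) (mul fa fb)) (∼-cong (φ-inv fb) (φ-++ fa fb))))

    comm-𝒫₁ : {a : Word (suc m)} → 𝒫 1 a → 𝒫 K (φ a)
    comm-𝒫₁ (base (inj₁ (a , b , fa , fb , refl))) = φ-comm fa fb
    comm-𝒫₁ (base (inj₂ (a , fa , refl))) =
      𝒫-resp K (≈-sym (comm-++ʳ x a a ⟫ ≡⇒≈ (sym (++-assoc (φ a) (φ a) _))))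
        (𝒫-mul K (𝒫-square (suc k) (φ∈𝒫 fa)) (𝒫-comm (suc k) (φ∈𝒫 fa) fa))
    comm-𝒫₁ one = 𝒫-resp K (≈-sym (comm-[]ʳ x)) (𝒫-one K)
    comm-𝒫₁ (mul {u} {v} p q) = 𝒫-resp K (≈-sym (comm-++ʳ x u v))
        (𝒫-mul K (comm-𝒫₁ q) (𝒫-mul K (comm-𝒫₁ p) (𝒫-step K (𝒫-comm K (comm-𝒫₁ p) (𝒫⊆F 1 q)))))
    comm-𝒫₁ (ginv {u} p) = 𝒫-resp K (≈-sym (comm-invʳ x u))
        (𝒫-mul K (𝒫-inv K (comm-𝒫₁ p)) (𝒫-step K (𝒫-comm K (𝒫-inv K (comm-𝒫₁ p)) (ginv (𝒫⊆F 1 p)))))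
    comm-𝒫₁ (resp e p) = 𝒫-resp K (comm-cong {a = x} ≈-refl e) (comm-𝒫₁ p)

-- Power maps along the series (a Hall–Petresco-type computation): modulo the
-- appropriate deeper term, the 2^s-power map is multiplicative on 𝒫 (k+1),
-- while on F it picks up the correction [b,a]^(2^(s-1)).
module PowerMaps (m : ℕ) where
  open import Data.Nat using (_+_)
  open Series m
  open CommutatorWith𝒫₁ using (comm-𝒫₁)

  𝒫-pow2 : (s k : ℕ) {g : Word (suc m)} → 𝒫 k g → 𝒫 (s + k) (pow2 s g)
  𝒫-pow2 zero k p = p
  𝒫-pow2 (suc s) k p = 𝒫-cast (+-suc s k) (𝒫-pow2 s (suc k) (𝒫-square k p))

  pow2-++ : (s k : ℕ) {a b : Word (suc m)} → 𝒫 (suc k) a → 𝒫 (suc k) b →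
    Factor (𝒫 (s + suc (suc k))) (pow2 s (a ++ b)) (pow2 s a ++ pow2 s b)
  pow2-++ zero k {a} {b} pa pb = [] , 𝒫-one (suc (suc k)) , ≡⇒≈ (sym (++-identityʳ (a ++ b)))
  pow2-++ (suc s) k {a} {b} pa pb =
    combine (pow2-++ s (suc k) (𝒫-square (suc k) pa) pb²c) (pow2-++ s (suc k) (𝒫-square (suc k) pb) (𝒫-step K pc))
    where
    open ≈-Reasoning
    K : ℕ
    K = suc (suc k)
    c : Word (suc m)
    c = conj b (comm b a)
    pc : 𝒫 (suc K) c
    pc = 𝒫-normal (suc K) b (comm-𝒫₁ (suc k) pb (𝒫⊆𝒫₁ k pa))
    pb²c : 𝒫 K ((b ++ b) ++ c)
    pb²c = 𝒫-mul K (𝒫-square (suc k) pb) (𝒫-step K pc)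
    combine : Factor (𝒫 (s + suc K)) (pow2 s ((a ++ a) ++ ((b ++ b) ++ c))) (pow2 s (a ++ a) ++ pow2 s ((b ++ b) ++ c)) →
              Factor (𝒫 (s + suc K)) (pow2 s ((b ++ b) ++ c)) (pow2 s (b ++ b) ++ pow2 s c) →
              Factor (𝒫 (suc s + K)) (pow2 (suc s) (a ++ b)) (pow2 (suc s) a ++ pow2 (suc s) b)
    combine (r₁ , pr₁ , h₁) (r₂ , pr₂ , h₂) =
      (pow2 s c ++ r₂ ++ r₁) ,
      𝒫-cast (+-suc s K) (𝒫-mul (s + suc K) (𝒫-pow2 s (suc K) pc) (𝒫-mul (s + suc K) pr₂ pr₁)) ,
      (begin
        pow2 s ((a ++ b) ++ (a ++ b))              ≈⟨ pow2-cong s (square-of-product a b) ⟩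
        pow2 s ((a ++ a) ++ ((b ++ b) ++ c))        ≈⟨ h₁ ⟩
        (pow2 s (a ++ a) ++ pow2 s ((b ++ b) ++ c)) ++ r₁
          ≈⟨ ++-congʳ r₁ (++-congˡ (pow2 s (a ++ a)) h₂) ⟩
        (pow2 s (a ++ a) ++ (pow2 s (b ++ b) ++ pow2 s c) ++ r₂) ++ r₁
          ≈⟨ solve ((x₀ ⊕ (x₁ ⊕ x₂) ⊕ x₃) ⊕ x₄) ((x₀ ⊕ x₁) ⊕ x₂ ⊕ x₃ ⊕ x₄) refl
               (pow2 s (a ++ a) ∷ pow2 s (b ++ b) ∷ pow2 s c ∷ r₂ ∷ r₁ ∷ []) ⟩
        (pow2 s (a ++ a) ++ pow2 s (b ++ b)) ++ pow2 s c ++ r₂ ++ r₁ ∎)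

  pow2-++-F : (t : ℕ) {a b : Word (suc m)} → F m a → F m b →
    Factor (𝒫 (t + 2)) (pow2 (suc t) (a ++ b)) ((pow2 (suc t) a ++ pow2 (suc t) b) ++ pow2 t (comm b a))
  pow2-++-F t {a} {b} fa fb =
    combine (pow2-++ t 0 (𝒫-square 0 fa) (mul (𝒫-square 0 fb) pc)) (pow2-++ t 0 (𝒫-square 0 fb) pc)
            (pow2-++ t 0 pg (𝒫-step 1 pe))
    where
    open ≈-Reasoning
    g : Word (suc m)
    g = comm b a
    pg : 𝒫 1 g
    pg = 𝒫-comm 0 fb fa
    e : Word (suc m)
    e = comm g b
    pe : 𝒫 2 e
    pe = 𝒫-comm 1 pg fb
    c : Word (suc m)
    c = conj b g
    pc : 𝒫 1 c
    pc = 𝒫-normal 1 b pg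
    c≈ge : c ≈ (g ++ e)
    c≈ge = solve (ι x₁ ⊕ [ x₁ , x₀ ]ₑ ⊕ x₁) ([ x₁ , x₀ ]ₑ ⊕ [ [ x₁ , x₀ ]ₑ , x₁ ]ₑ) refl (a ∷ b ∷ [])
    combine : Factor (𝒫 (t + 2)) (pow2 t ((a ++ a) ++ ((b ++ b) ++ c))) (pow2 t (a ++ a) ++ pow2 t ((b ++ b) ++ c)) →
              Factor (𝒫 (t + 2)) (pow2 t ((b ++ b) ++ c)) (pow2 t (b ++ b) ++ pow2 t c) →
              Factor (𝒫 (t + 2)) (pow2 t (g ++ e)) (pow2 t g ++ pow2 t e) →
              Factor (𝒫 (t + 2)) (pow2 (suc t) (a ++ b)) ((pow2 (suc t) a ++ pow2 (suc t) b) ++ pow2 t g)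
    combine (r₁ , pr₁ , h₁) (r₂ , pr₂ , h₂) (r₃ , pr₃ , h₃) =
      (pow2 t e ++ r₃ ++ r₂ ++ r₁) ,
      𝒫-mul (t + 2) (𝒫-pow2 t 2 pe) (𝒫-mul (t + 2) pr₃ (𝒫-mul (t + 2) pr₂ pr₁)) ,
      (begin
        pow2 t ((a ++ b) ++ (a ++ b))              ≈⟨ pow2-cong t (square-of-product a b) ⟩
        pow2 t ((a ++ a) ++ ((b ++ b) ++ c))        ≈⟨ h₁ ⟩
        (pow2 t (a ++ a) ++ pow2 t ((b ++ b) ++ c)) ++ r₁
          ≈⟨ ++-congʳ r₁ (++-congˡ (pow2 t (a ++ a)) h₂) ⟩
        (pow2 t (a ++ a) ++ (pow2 t (b ++ b) ++ pow2 t c) ++ r₂) ++ r₁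
          ≈⟨ ++-congʳ r₁ (++-congˡ (pow2 t (a ++ a)) (++-congʳ r₂ (++-congˡ (pow2 t (b ++ b)) (pow2-cong t c≈ge ⟫ h₃)))) ⟩
        (pow2 t (a ++ a) ++ (pow2 t (b ++ b) ++ (pow2 t g ++ pow2 t e) ++ r₃) ++ r₂) ++ r₁
          ≈⟨ solve ((x₀ ⊕ (x₁ ⊕ (x₂ ⊕ x₃) ⊕ x₄) ⊕ x₅) ⊕ x₆) (((x₀ ⊕ x₁) ⊕ x₂) ⊕ x₃ ⊕ x₄ ⊕ x₅ ⊕ x₆) refl
               (pow2 t (a ++ a) ∷ pow2 t (b ++ b) ∷ pow2 t g ∷ pow2 t e ∷ r₃ ∷ r₂ ∷ r₁ ∷ []) ⟩
        ((pow2 t (a ++ a) ++ pow2 t (b ++ b)) ++ pow2 t g) ++ pow2 t e ++ r₃ ++ r₂ ++ r₁ ∎)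

-- It lies in 𝒫 n and [𝒬 n, F] ⊆ 𝒬 (n+1),
-- so every left-normed commutator [f₀, …, fₙ] of elements of F lies in 𝒬 n.
module CommutatorLayers (m : ℕ) where
  open import Data.Nat using (_+_)
  open Series m

  -- [c, z b₁, …, z bₙ]; thus leftComm m (a ∷ as) = commWith (y m) (y m a) as
  commWith : (Fin m → Word (suc m)) → Word (suc m) → List (Fin m) → Word (suc m)
  commWith z = foldl (λ c b → comm c (z b))

  Basic : ℕ → Word (suc m) → Set
  Basic n w = Σ (List (Fin m)) λ as → length as ≡ n × w ≡ leftComm m as

  𝒬 : ℕ → Word (suc m) → Set
  𝒬 n = Gen (λ w → Basic (suc n) w ⊎ 𝒫 (suc n) w)

  y∈F : (a : Fin m) → F m (y m a)
  y∈F a = base (a , refl)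

  commWith-∈𝒫 : (z : Fin m → Word (suc m)) → (∀ b → F m (z b)) →
    (bs : List (Fin m)) (n : ℕ) {c : Word (suc m)} → 𝒫 n c → 𝒫 (length bs + n) (commWith z c bs)
  commWith-∈𝒫 z z∈F [] n p = p
  commWith-∈𝒫 z z∈F (b ∷ bs) n p =
    𝒫-cast (+-suc (length bs) n) (commWith-∈𝒫 z z∈F bs (suc n) (𝒫-comm n p (z∈F b)))

  basic∈𝒫 : (n : ℕ) {w : Word (suc m)} → Basic (suc n) w → 𝒫 n w
  basic∈𝒫 n (a ∷ as , refl , refl) = 𝒫-cast (+-identityʳ (length as)) (commWith-∈𝒫 (y m) y∈F as 0 (y∈F a))

  𝒬⊆𝒫 : (n : ℕ) {w : Word (suc m)} → 𝒬 n w → 𝒫 n w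
  𝒬⊆𝒫 n = Gen-least (𝒫-isSubgroup n) λ { (inj₁ b) → basic∈𝒫 n b ; (inj₂ p) → 𝒫-step n p }

  𝒫⊆𝒬 : (n : ℕ) {w : Word (suc m)} → 𝒫 (suc n) w → 𝒬 n w
  𝒫⊆𝒬 n p = base (inj₂ p)

  F⊆𝒬₀ : {w : Word (suc m)} → F m w → 𝒬 0 w
  F⊆𝒬₀ = Gen-least (Gen-isSubgroup _) λ { (b , refl) → base (inj₁ (b ∷ [] , refl , refl)) }

  -- [x, u] for x basic and u ∈ F: by induction on u, with [x, y_b] basic and the
  -- remaining terms of the expansions of [x, uv] and [x, u⁻¹] lying in 𝒫 (n+2)
  comm-basic : (n : ℕ) (as : List (Fin m)) → length as ≡ suc n →
    {u : Word (suc m)} → F m u → 𝒬 (suc n) (comm (leftComm m as) u)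
  comm-basic n (a ∷ as) len (base (b , refl)) =
    base (inj₁ ((a ∷ as) ∷ʳ b , longer , sym (foldl-∷ʳ (λ c b → comm c (y m b)) (y m a) b as)))
    where
    longer : length ((a ∷ as) ∷ʳ b) ≡ suc (suc n)
    longer = trans (length-++ (a ∷ as)) (trans (+-comm (length (a ∷ as)) 1) (cong suc len))
  comm-basic n as len one = resp (≈-sym (comm-[]ʳ (leftComm m as))) one
  comm-basic n as len (mul {u} {v} p q) = resp (≈-sym (comm-++ʳ x u v))
      (mul (comm-basic n as len q) (mul (comm-basic n as len p) (𝒫⊆𝒬 (suc n) (𝒫-comm (suc n) (𝒫-comm n px p) q))))
    where
    x : Word (suc m)
    x = leftComm m as
    px : 𝒫 n x
    px = basic∈𝒫 n (as , len , refl)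
  comm-basic n as len (ginv {u} p) = resp (≈-sym (comm-invʳ x u))
      (mul (ginv (comm-basic n as len p))
        (𝒫⊆𝒬 (suc n) (𝒫-comm (suc n) (𝒫-inv (suc n) (𝒫-comm n px p)) (ginv p))))
    where
    x : Word (suc m)
    x = leftComm m as
    px : 𝒫 n x
    px = basic∈𝒫 n (as , len , refl)
  comm-basic n as len (resp e p) = resp (comm-cong {a = leftComm m as} ≈-refl e) (comm-basic n as len p)

  comm-𝒬 : (n : ℕ) {x u : Word (suc m)} → 𝒬 n x → F m u → 𝒬 (suc n) (comm x u)
  comm-𝒬 n (base (inj₁ (as , len , refl))) fu = comm-basic n as len fu
  comm-𝒬 n (base (inj₂ p)) fu = 𝒫⊆𝒬 (suc n) (𝒫-comm (suc n) p fu)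
  comm-𝒬 n {u = u} one fu = resp (≈-sym (comm-[]ˡ u)) one
  comm-𝒬 n {u = u} (mul {x₁} {x₂} p q) fu = resp (≈-sym (comm-++ˡ x₁ x₂ u))
    (mul (comm-𝒬 n p fu)
      (mul (𝒫⊆𝒬 (suc n) (𝒫-comm (suc n) (𝒫-comm n (𝒬⊆𝒫 n p) fu) (𝒫⊆F n (𝒬⊆𝒫 n q)))) (comm-𝒬 n q fu)))
  comm-𝒬 n {u = u} (ginv {x} p) fu = resp (≈-sym (comm-invˡ x u))
    (mul (ginv (comm-𝒬 n p fu))
      (𝒫⊆𝒬 (suc n) (𝒫-comm (suc n) (𝒫-inv (suc n) (𝒫-comm n (𝒬⊆𝒫 n p) fu)) (𝒫⊆F n (𝒫-inv n (𝒬⊆𝒫 n p))))))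
  comm-𝒬 n {u = u} (resp e p) fu = resp (comm-cong {b = u} e ≈-refl) (comm-𝒬 n p fu)

  commWith-∈𝒬 : (z : Fin m → Word (suc m)) → (∀ b → F m (z b)) →
    (bs : List (Fin m)) (n : ℕ) {c : Word (suc m)} → 𝒬 n c → 𝒬 (length bs + n) (commWith z c bs)
  commWith-∈𝒬 z z∈F [] n q = q
  commWith-∈𝒬 z z∈F (b ∷ bs) n {c} q =
    subst (λ k → 𝒬 k (commWith z (comm c (z b)) bs)) (+-suc (length bs) n)
      (commWith-∈𝒬 z z∈F bs (suc n) (comm-𝒬 n q (z∈F b)))

module PermutationAction (m : ℕ) (σ : Permutation′ (suc m)) where
  open Series m
  open CommutatorLayers m using (commWith)

  private
    σ̂ : Fin (suc m) → Fin (suc m)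
    σ̂ k = σ ⟨$⟩ʳ k

  act-cong : {u v : Word (suc m)} → u ≈ v → act m σ u ≈ act m σ v
  act-cong ≈-refl = ≈-refl
  act-cong (≈-sym p) = ≈-sym (act-cong p)
  act-cong (≈-trans p q) = act-cong p ⟫ act-cong q
  act-cong (≈-cancel u k v) =
    ≡⇒≈ (map-++ σ̂ u (k ∷ k ∷ v)) ⟫ ≈-cancel (map σ̂ u) (σ̂ k) (map σ̂ v) ⟫ ≡⇒≈ (sym (map-++ σ̂ u v))

  act-isEndo : IsEndo (act m σ)
  act-isEndo = record
    { f-cong = act-cong ; f-++ = λ u v → ≡⇒≈ (map-++ σ̂ u v)
    ; f-inv = λ u → ≡⇒≈ (reverse-map σ̂ u) ; f-[] = ≈-refl }

  act-F : {w : Word (suc m)} → F m w → F m (act m σ w)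
  act-F = Gen-image act-isEndo λ { (a , refl) → pair∈F (σ̂ (inject₁ a)) (σ̂ (fromℕ m)) }

  act-𝒫 : (k : ℕ) {w : Word (suc m)} → 𝒫 k w → 𝒫 k (act m σ w)
  act-𝒫 = 𝒫-preserved act-isEndo act-F

  act-pow2 : (s : ℕ) (u : Word (suc m)) → act m σ (pow2 s u) ≡ pow2 s (act m σ u)
  act-pow2 zero u = refl
  act-pow2 (suc s) u = trans (act-pow2 s (u ++ u)) (cong (pow2 s) (map-++ σ̂ u u))

  act-comm : (u v : Word (suc m)) → act m σ (comm u v) ≡ comm (act m σ u) (act m σ v)
  act-comm u v = trans (map-++ σ̂ (inv u) _) (cong₂ _++_ (reverse-map σ̂ u)
    (trans (map-++ σ̂ (inv v) _) (cong₂ _++_ (reverse-map σ̂ v) (map-++ σ̂ u v))))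

  act-commWith : (as : List (Fin m)) (c : Word (suc m)) →
    act m σ (commWith (y m) c as) ≡ commWith (λ b → act m σ (y m b)) (act m σ c) as
  act-commWith [] c = refl
  act-commWith (b ∷ as) c =
    trans (act-commWith as (comm c (y m b)))
      (cong (λ w → commWith (λ b → act m σ (y m b)) w as) (act-comm c (y m b)))

module Invariance (m : ℕ) where
  open import Data.Nat using (_+_)
  open Series m
  open PowerMaps m
  open CommutatorLayers m

  M-𝒫 : {i j : ℕ} {w : Word (suc m)} → 𝒫 i w → M m i j w
  M-𝒫 p = base (inj₁ p)

  M-power : {i j s : ℕ} (as : List (Fin m)) → j ≤ s → suc s ≤ i → length as ≡ i ∸ s →
            M m i j (pow2 s (leftComm m as))
  M-power {s = s} as js si len = base (inj₂ (s , js , si , as , len , refl))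

  M-cast : {i i′ j : ℕ} {w : Word (suc m)} → i ≡ i′ → M m i j w → M m i′ j w
  M-cast refl p = p

  -- for weight ≥ 2 the power map is multiplicative modulo 𝒫 i ⊆ M_{i,j}
  pow2-𝒬∈M : {j : ℕ} (s k : ℕ) → j ≤ s → {x : Word (suc m)} → 𝒬 (suc k) x →
             M m (s + suc (suc k)) j (pow2 s x)
  pow2-𝒬∈M s k js (base (inj₁ (as , len , refl))) =
    M-power as js (subst (suc s ≤_) (sym (+-suc s (suc k))) (s≤s (m≤m+n s (suc k))))
      (trans len (sym (m+n∸m≡n s (suc (suc k)))))
  pow2-𝒬∈M s k js (base (inj₂ p)) = M-𝒫 (𝒫-pow2 s (suc (suc k)) p)
  pow2-𝒬∈M s k js one = resp (≡⇒≈ (sym (pow2-[] s))) one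
  pow2-𝒬∈M s k js (mul p q) with pow2-++ s k (𝒬⊆𝒫 (suc k) p) (𝒬⊆𝒫 (suc k) q)
  ... | r , pr , h = resp (≈-sym h) (mul (mul (pow2-𝒬∈M s k js p) (pow2-𝒬∈M s k js q)) (M-𝒫 pr))
  pow2-𝒬∈M s k js (ginv {x} p) = resp (≡⇒≈ (sym (pow2-inv s x))) (ginv (pow2-𝒬∈M s k js p))
  pow2-𝒬∈M s k js (resp e p) = resp (pow2-cong s e) (pow2-𝒬∈M s k js p)

  -- for weight 1 the correction [b,a]^(2^t) lies in M_{t+2,j} because j ≤ t
  pow2-F∈M : {j : ℕ} (t : ℕ) → j ≤ t → {x : Word (suc m)} → F m x → M m (suc (suc t)) j (pow2 (suc t) x)
  pow2-F∈M t jt (base (a , refl)) = M-power (a ∷ []) (≤-trans jt (n≤1+n t)) ≤-refl (sym (m+n∸n≡m 1 (suc t)))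
  pow2-F∈M t jt one = resp (≡⇒≈ (sym (pow2-[] (suc t)))) one
  pow2-F∈M {j} t jt (mul {u} {v} p q) = assemble (pow2-++-F t p q)
    where
    correction : M m (suc (suc t)) j (pow2 t (comm v u))
    correction = M-cast (+-comm t 2) (pow2-𝒬∈M t 0 jt (comm-𝒬 0 (F⊆𝒬₀ q) p))
    assemble : Factor (𝒫 (t + 2)) (pow2 (suc t) (u ++ v)) ((pow2 (suc t) u ++ pow2 (suc t) v) ++ pow2 t (comm v u)) →
               M m (suc (suc t)) j (pow2 (suc t) (u ++ v))
    assemble (r , pr , h) = resp (≈-sym h)
      (mul (mul (mul (pow2-F∈M t jt p) (pow2-F∈M t jt q)) correction) (M-𝒫 {w = r} (𝒫-cast (+-comm t 2) pr)))
  pow2-F∈M t jt (ginv {x} p) = resp (≡⇒≈ (sym (pow2-inv (suc t) x))) (ginv (pow2-F∈M t jt p))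
  pow2-F∈M t jt (resp e p) = resp (pow2-cong (suc t) e) (pow2-F∈M t jt p)

  generator-weight : {i s n : ℕ} → suc s ≤ i → n ≡ i ∸ s → i ≡ s + n
  generator-weight {i} {s} si len = trans (sym (m+[n∸m]≡n (<⇒≤ si))) (cong (s +_) (sym len))

  𝒬-cast : {k l : ℕ} {w : Word (suc m)} → k ≡ l → 𝒬 k w → 𝒬 l w
  𝒬-cast refl q = q

  M-generator : ℕ → ℕ → Word (suc m) → Set
  M-generator i j w = 𝒫 i w
    ⊎ (Σ ℕ λ s → j ≤ s × suc s ≤ i ×
        Σ (List (Fin m)) λ as → length as ≡ i ∸ s × w ≡ pow2 s (leftComm m as))

  module _ (σ : Permutation′ (suc m)) where
    open PermutationAction m σ

    -- σ maps a power generator [y a, y b₁, …, y bₙ]^(2^s) of M_{i,j} to the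
    -- power [z a, z b₁, …, z bₙ]^(2^s) with z b = σ(y b) ∈ F, which lies in
    -- M_{i,j} by pow2-F∈M (n = 0, where j ≤ i-2 = s-1 is used) or pow2-𝒬∈M
    act-power∈M : {i′ j s : ℕ} → j ≤ i′ → j ≤ s → (a : Fin m) (bs : List (Fin m)) →
      suc (suc i′) ≡ s + suc (length bs) → M m (suc (suc i′)) j (act m σ (pow2 s (leftComm m (a ∷ bs))))
    act-power∈M {i′} {j} {s} ji js a bs ie =
      resp (≡⇒≈ (sym (trans (act-pow2 s _) (cong (pow2 s) (act-commWith bs (y m a)))))) (by-weight bs ie)
      where
      z : Fin m → Word (suc m)
      z b = act m σ (y m b)
      z∈F : (b : Fin m) → F m (z b)
      z∈F b = act-F (y∈F b)
      by-weight : (bs : List (Fin m)) → suc (suc i′) ≡ s + suc (length bs) →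
                  M m (suc (suc i′)) j (pow2 s (commWith z (z a) bs))
      by-weight [] ie = subst (λ s → M m (suc (suc i′)) j (pow2 s (z a))) s≡1+i′ (pow2-F∈M i′ ji (z∈F a))
        where
        s≡1+i′ : suc i′ ≡ s
        s≡1+i′ = suc-injective (trans ie (+-comm s 1))
      by-weight (b ∷ bs) ie =
        M-cast (sym ie) (pow2-𝒬∈M s (length bs) js
          (𝒬-cast (cong suc (+-identityʳ (length bs))) (commWith-∈𝒬 z z∈F (b ∷ bs) 0 (F⊆𝒬₀ (z∈F a)))))

    M-invariant : (i′ j : ℕ) → j ≤ i′ → {w : Word (suc m)} →
                  M m (suc (suc i′)) j w → M m (suc (suc i′)) j (act m σ w)
    M-invariant i′ j ji = Gen-image act-isEndo on-generators
      where
      on-generators : {w : Word (suc m)} → M-generator (suc (suc i′)) j w → M m (suc (suc i′)) j (act m σ w)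
      on-generators (inj₁ p) = M-𝒫 (act-𝒫 (suc (suc i′)) p)
      on-generators (inj₂ (s , js , si , [] , len , refl)) =
        ⊥-elim (1+n≰n (subst (suc s ≤_) (trans (generator-weight si len) (+-identityʳ s)) si))
      on-generators (inj₂ (s , js , si , a ∷ bs , len , refl)) =
        act-power∈M ji js a bs (generator-weight si len)

module PowersOfTwo where
  open import Data.Integer using (ℤ; +_; -[1+_]; _+_; _*_; 0ℤ; 1ℤ)
  open import Data.Integer.Properties using (i*j≡0⇒i≡0∨j≡0)

  two^ : ℕ → ℤ
  two^ zero = 1ℤ
  two^ (suc k) = + 2 * two^ k

  two^≢0 : (s : ℕ) → two^ s ≡ 0ℤ → ⊥
  two^≢0 zero ()
  two^≢0 (suc s) e with i*j≡0⇒i≡0∨j≡0 (+ 2) e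
  ... | inj₂ e′ = two^≢0 s e′

  odd≢0 : (z : ℤ) → 1ℤ + + 2 * z ≡ 0ℤ → ⊥
  odd≢0 (+ zero) ()
  odd≢0 (+ suc n) ()
  odd≢0 -[1+ zero ] ()
  odd≢0 -[1+ suc n ] ()

open PowersOfTwo

-- An affine representation of W_d on ℤ: for t : Fin d → ℤ the letter x_k acts
-- as the reflection x ↦ t k − x.  Elements of F act as translations, and the
-- elements of 𝒫 k translate by multiples of 2^k.
module Reflections (m : ℕ) (t : Fin (suc m) → Data.Integer.ℤ) where
  open import Data.Integer using (ℤ; +_; _+_; _*_; -_; _-_; 0ℤ; 1ℤ)
  open import Data.Integer.Tactic.RingSolver using (solve-∀)
  open Series m
  open import Data.Integer.Properties
    using (*-identityˡ; *-zeroʳ; *-distribˡ-+; neg-distribʳ-*) renaming (+-identityʳ to +-identityʳℤ)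

  ev : Word (suc m) → ℤ → ℤ
  ev [] x = x
  ev (k ∷ w) x = t k - ev w x

  ev-++ : (u v : Word (suc m)) (x : ℤ) → ev (u ++ v) x ≡ ev u (ev v x)
  ev-++ [] v x = refl
  ev-++ (k ∷ u) v x = cong (λ z → t k - z) (ev-++ u v x)

  reflection-involutive : (a b : ℤ) → a - (a - b) ≡ b
  reflection-involutive = solve-∀

  ev-cong : {u v : Word (suc m)} → u ≈ v → (x : ℤ) → ev u x ≡ ev v x
  ev-cong ≈-refl x = refl
  ev-cong (≈-sym p) x = sym (ev-cong p x)
  ev-cong (≈-trans p q) x = trans (ev-cong p x) (ev-cong q x)
  ev-cong (≈-cancel u k v) x =
    trans (ev-++ u (k ∷ k ∷ v) x)
      (trans (cong (ev u) (reflection-involutive (t k) (ev v x))) (sym (ev-++ u v x)))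

  ev-inv : (u : Word (suc m)) (x : ℤ) → ev (inv u) (ev u x) ≡ x
  ev-inv [] x = refl
  ev-inv (k ∷ u) x =
    trans (cong (λ w → ev w (t k - ev u x)) (unfold-reverse k u))
      (trans (ev-++ (reverse u) [ k ] _)
        (trans (cong (ev (reverse u)) (reflection-involutive (t k) (ev u x))) (ev-inv u x)))

  Translation : Word (suc m) → ℤ → Set
  Translation w c = (x : ℤ) → ev w x ≡ x + c

  translation-inv : {u : Word (suc m)} {c : ℤ} → Translation u c → Translation (inv u) (- c)
  translation-inv {u} {c} tu x =
    trans (cong (ev (inv u)) (sym (trans (tu (x - c)) (x-c+c x c)))) (ev-inv u (x - c))
    where
    x-c+c : (x c : ℤ) → x - c + c ≡ x
    x-c+c = solve-∀

  translation-++ : {u v : Word (suc m)} {a b : ℤ} → Translation u a → Translation v b → Translation (u ++ v) (a + b)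
  translation-++ {u} {v} {a} {b} tu tv x =
    trans (ev-++ u v x) (trans (tu (ev v x)) (trans (cong (λ z → z + a) (tv x)) (reassoc x a b)))
    where
    reassoc : (x a b : ℤ) → x + b + a ≡ x + (a + b)
    reassoc = solve-∀

  translation-pow2 : (s : ℕ) {u : Word (suc m)} {c : ℤ} → Translation u c → Translation (pow2 s u) (two^ s * c)
  translation-pow2 zero {u} {c} tu x = trans (tu x) (cong (λ z → x + z) (sym (*-identityˡ c)))
  translation-pow2 (suc s) {u} {c} tu x =
    trans (translation-pow2 s (translation-++ {u} {u} tu tu) x) (cong (λ z → x + z) (double (two^ s) c))
    where
    double : (p c : ℤ) → p * (c + c) ≡ (+ 2 * p) * c
    double = solve-∀

  Shift : ℕ → Word (suc m) → Set
  Shift k w = Σ ℤ λ z → Translation w (two^ k * z)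

  Shift-isSubgroup : (k : ℕ) → IsSubgroup (Shift k)
  Shift-isSubgroup k = record
    { ∈-one  = 0ℤ , λ x → sym (trans (cong (λ z → x + z) (*-zeroʳ (two^ k))) (+-identityʳℤ x))
    ; ∈-mul  = λ { {u} {v} (a , tu) (b , tv) →
        (a + b) , λ x → trans (translation-++ {u} {v} tu tv x) (cong (λ z → x + z) (sym (*-distribˡ-+ (two^ k) a b))) }
    ; ∈-inv  = λ { {u} (a , tu) → (- a) , λ x → trans (translation-inv {u} tu x) (cong (λ z → x + z) (neg-distribʳ-* (two^ k) a)) }
    ; ∈-resp = λ { e (a , tu) → a , λ x → trans (sym (ev-cong e x)) (tu x) } }

  -- 𝒫 k ⊆ Shift k: y_a translates by t a − t d; commutators of translations
  -- are trivial, and squaring doubles the translation length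
  𝒫⊆Shift : (k : ℕ) {w : Word (suc m)} → 𝒫 k w → Shift k w
  𝒫⊆Shift zero = Gen-least (Shift-isSubgroup 0) λ
    { (a , refl) → (t (inject₁ a) - t (fromℕ m)) , λ x → y-translation x (t (inject₁ a)) (t (fromℕ m)) }
    where
    y-translation : (x p q : ℤ) → p - (q - x) ≡ x + 1ℤ * (p - q)
    y-translation = solve-∀
  𝒫⊆Shift (suc k) = Gen-least (Shift-isSubgroup (suc k)) on-generators
    where
    on-generators : {w : Word (suc m)} → 𝒫-generator k w → Shift (suc k) w
    on-generators (inj₁ (a , b , pa , fb , refl)) with 𝒫⊆Shift k pa | 𝒫⊆Shift 0 fb
    ... | za , ta | zb , tb = 0ℤ , λ x →
      trans (translation-++ {inv a} (translation-inv {a} ta)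
              (translation-++ {inv b} (translation-inv {b} tb) (translation-++ {a} {b} ta tb)) x)
            (commutator-translation x (two^ k) za zb)
      where
      commutator-translation : (x p za zb : ℤ) →
        x + (- (p * za) + (- (1ℤ * zb) + (p * za + 1ℤ * zb))) ≡ x + (+ 2 * p) * 0ℤ
      commutator-translation = solve-∀
    on-generators (inj₂ (a , pa , refl)) with 𝒫⊆Shift k pa
    ... | za , ta = za , λ x → trans (translation-++ {a} {a} ta ta x) (square-translation x (two^ k) za)
      where
      square-translation : (x p za : ℤ) → x + (p * za + p * za) ≡ x + (+ 2 * p) * za
      square-translation = solve-∀

  -- M_{i,i} = P_{i+1}: its power generators would need i ≤ s ≤ i-1
  Mᵢᵢ⊆Shift : (i : ℕ) {w : Word (suc m)} → M m i i w → Shift i w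
  Mᵢᵢ⊆Shift i = Gen-least (Shift-isSubgroup i) λ
    { (inj₁ p) → 𝒫⊆Shift i p
    ; (inj₂ (s , is , si , _)) → ⊥-elim (1+n≰n (≤-trans si is)) }

-- The witness is w = y_a^(2^(i-1)); the obstruction is found
-- in the reflection representation for a suitable choice of t.
module Faithfulness (m : ℕ) (σ : Permutation′ (suc m)) where
  open import Data.Integer using (ℤ; +_; _+_; _*_; -_; _-_; 0ℤ; 1ℤ)
  open import Data.Integer.Properties using (i*j≡0⇒i≡0∨j≡0; +-identityˡ)
  open import Data.Integer.Tactic.RingSolver using (solve-∀)
  open Invariance m using (M-power)
  open PermutationAction m σ using (act-pow2)
  open Reflections m using (Translation; translation-inv; translation-++; translation-pow2; Mᵢᵢ⊆Shift)

  σ̂ : Fin (suc m) → Fin (suc m)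
  σ̂ k = σ ⟨$⟩ʳ k

  xd : Fin (suc m)
  xd = fromℕ m

  test-element : ℕ → Fin m → Word (suc m)
  test-element i′ a = pow2 (suc i′) (y m a)

  test-element∈M : (i′ : ℕ) (a : Fin m) → M m (suc (suc i′)) i′ (test-element i′ a)
  test-element∈M i′ a = M-power (a ∷ []) (n≤1+n i′) ≤-refl (sym (m+n∸n≡m 1 (suc i′)))

  Detects : (Fin (suc m) → ℤ) → Fin m → Set
  Detects t a = t (σ̂ (inject₁ a)) - t (σ̂ xd) ≡ (t (inject₁ a) - t xd) - 1ℤ

  -- then w⁻¹σ(w) translates by 2^(i-1)·(−1), no multiple of 2^i, so it is not in M_{i,i}
  detected : (i′ : ℕ) (t : Fin (suc m) → ℤ) (a : Fin m) → Detects t a →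
    M m (suc (suc i′)) (suc (suc i′)) (inv (test-element i′ a) ++ act m σ (test-element i′ a)) → ⊥
  detected i′ t a det w⁻¹σw∈M with Mᵢᵢ⊆Shift t (suc (suc i′)) w⁻¹σw∈M
  ... | z , shift with i*j≡0⇒i≡0∨j≡0 (two^ s) (odd-multiple (two^ s) A z lengths-agree)
    where
    open Reflections m t using (ev)
    s : ℕ
    s = suc i′
    A : ℤ
    A = t (inject₁ a) - t xd
    pair : (p q : Fin (suc m)) → Translation t (p ∷ q ∷ []) (t p - t q)
    pair p q x = translate (t p) (t q) x
      where
      translate : (a b x : ℤ) → a - (b - x) ≡ x + (a - b)
      translate = solve-∀
    w-translation : Translation t (test-element i′ a) (two^ s * A)
    w-translation = translation-pow2 t s {y m a} (pair (inject₁ a) xd)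
    σw-translation : Translation t (act m σ (test-element i′ a)) (two^ s * (A - 1ℤ))
    σw-translation x =
      trans (cong (λ u → ev u x) (act-pow2 s (y m a)))
        (trans (translation-pow2 t s {act m σ (y m a)} (pair (σ̂ (inject₁ a)) (σ̂ xd)) x) (cong (λ c → x + two^ s * c) det))
    lengths-agree : two^ (suc s) * z ≡ - (two^ s * A) + two^ s * (A - 1ℤ)
    lengths-agree = trans (sym (+-identityˡ _)) (trans (sym (shift 0ℤ))
      (trans (translation-++ t {inv (test-element i′ a)} (translation-inv t {test-element i′ a} w-translation)
        σw-translation 0ℤ) (+-identityˡ _)))
    odd-multiple : (p A z : ℤ) → (+ 2 * p) * z ≡ - (p * A) + p * (A - 1ℤ) → p * (1ℤ + + 2 * z) ≡ 0ℤ
    odd-multiple p A z e = trans (expand p z) (trans (cong (λ q → p + q) e) (cancel p A))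
      where
      expand : (p z : ℤ) → p * (1ℤ + + 2 * z) ≡ p + (+ 2 * p) * z
      expand = solve-∀
      cancel : (p A : ℤ) → p + (- (p * A) + p * (A - 1ℤ)) ≡ 0ℤ
      cancel = solve-∀
  ... | inj₁ e = two^≢0 (suc i′) e
  ... | inj₂ e = odd≢0 z e

  δ : Fin (suc m) → Fin (suc m) → ℤ
  δ c x with x Fin.≟ c
  ... | yes _ = 1ℤ
  ... | no _ = 0ℤ

  δ-same : (c : Fin (suc m)) → δ c c ≡ 1ℤ
  δ-same c with c Fin.≟ c
  ... | yes _ = refl
  ... | no c≢c = ⊥-elim (c≢c refl)

  δ-other : {c x : Fin (suc m)} → ¬ x ≡ c → δ c x ≡ 0ℤ
  δ-other {c} {x} x≢c with x Fin.≟ c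
  ... | yes x≡c = ⊥-elim (x≢c x≡c)
  ... | no _ = refl

  σ̂-injective : {x x′ : Fin (suc m)} → σ̂ x ≡ σ̂ x′ → x ≡ x′
  σ̂-injective e = trans (sym (inverseˡ σ)) (trans (cong (σ ⟨$⟩ˡ_) e) (inverseˡ σ))

  detects-from-values : {t : Fin (suc m) → ℤ} {a : Fin m} {p q r u : ℤ} →
    t (σ̂ (inject₁ a)) ≡ p → t (σ̂ xd) ≡ q → t (inject₁ a) ≡ r → t xd ≡ u →
    p - q ≡ (r - u) - 1ℤ → Detects t a
  detects-from-values refl refl refl refl e = e

  -- with d ≥ 3 there is a letter x_a, a < d, different from any given letter
  avoid : 2 ≤ m → (e : Fin (suc m)) → Σ (Fin m) λ a → ¬ inject₁ a ≡ e
  avoid (s≤s (s≤s z≤n)) e with inject₁ zero Fin.≟ e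
  ... | yes 0≡e = suc zero , λ 1≡e → 0≢1 (trans 0≡e (sym 1≡e))
    where
    0≢1 : ¬ inject₁ {n = m} zero ≡ inject₁ (suc zero)
    0≢1 ()
  ... | no 0≢e = zero , 0≢e

  -- every σ ≠ 1 is detected by an indicator function: if σ fixes x_d, use the
  -- indicator of a moved letter x_a; otherwise that of σ(x_d), at a letter
  -- x_a ≠ σ(x_d) with a < d
  detectable : 2 ≤ m → (k : Fin (suc m)) → ¬ σ̂ k ≡ k → Σ (Fin (suc m) → ℤ) λ t → Σ (Fin m) (Detects t)
  detectable m≥2 k σk≢k with σ̂ xd Fin.≟ xd
  ... | yes σd≡d = fixes-xd (last-or-inject k)
    where
    fixes-xd : (k ≡ xd) ⊎ (Σ (Fin m) λ a → k ≡ inject₁ a) → Σ (Fin (suc m) → ℤ) λ t → Σ (Fin m) (Detects t)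
    fixes-xd (inj₁ refl) = ⊥-elim (σk≢k σd≡d)
    fixes-xd (inj₂ (a , refl)) = δ k , a ,
      detects-from-values {δ k} {a} (δ-other σk≢k) (trans (cong (δ k) σd≡d) (δ-other Fin.fromℕ≢inject₁))
        (δ-same k) (δ-other Fin.fromℕ≢inject₁) refl
  ... | no σd≢d with avoid m≥2 (σ̂ xd)
  ...   | a , a≢σd = δ (σ̂ xd) , a ,
      detects-from-values {δ (σ̂ xd)} {a} (δ-other (λ e → Fin.fromℕ≢inject₁ (sym (σ̂-injective e)))) (δ-same (σ̂ xd))
        (δ-other a≢σd) (δ-other (σd≢d ∘ sym)) refl

  faithful : 2 ≤ m → (i′ : ℕ) →
    ((w : Word (suc m)) → M m (suc (suc i′)) i′ w → M m (suc (suc i′)) (suc (suc i′)) (inv w ++ act m σ w)) →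
    (k : Fin (suc m)) → σ̂ k ≡ k
  faithful m≥2 i′ trivial-on-quotient k with σ̂ k Fin.≟ k
  ... | yes σk≡k = σk≡k
  ... | no σk≢k with detectable m≥2 k σk≢k
  ...   | t , a , det = ⊥-elim (detected i′ t a det (trivial-on-quotient _ (test-element∈M i′ a)))

proposition5p3 : (m : ℕ) → 2 ≤ m → (i : ℕ) → 2 ≤ i →
    ((j : ℕ) → j ≤ i ∸ 2 → (σ : Permutation′ (suc m)) → (w : Word (suc m)) →
        M m i j w → M m i j (act m σ w))
    × ((σ : Permutation′ (suc m)) →
        ((w : Word (suc m)) → M m i (i ∸ 2) w → M m i i (inv w ++ act m σ w)) →
        (k : Fin (suc m)) → σ ⟨$⟩ʳ k ≡ k)
proposition5p3 m m≥2 (suc (suc i′)) (s≤s (s≤s z≤n)) =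
  (λ j j≤i′ σ w w∈M → Invariance.M-invariant m σ i′ j j≤i′ w∈M) ,
  (λ σ trivial-on-quotient → Faithfulness.faithful m σ m≥2 i′ trivial-on-quotient)
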